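{- Let $G$ and $H$ be $n$-valued well-tempered games of different parities. Then $G$ and $H$ are $\{\oplus_n\}$-indistinguishable if and only if $(L(G),R(G))=(L(G+*),R(G+*))=(L(H),R(H))=(L(H+*),R(H+*))=(n-1,n-1)$, where $*=\langle 0\mid 0\rangle$.
   Context: For $S\subseteq\mathbb{Z}$: an even-tempered $S$-valued game is an element of $S$ (a "number", with no options) or $\langle L\mid R\rangle$ with $L,R$ finite nonempty sets of odd-tempered $S$-valued games; an odd-tempered one is $\langle L\mid R\rangle$ with $L,R$ finite nonempty sets of even-tempered $S$-valued games. An $n$-valued game is an $S$-valued game with $S=\{0,1,\dots,n-1\}$ ($n$ a positive integer). Outcomes: $L(m)=R(m)=m$ for numbers; otherwise $L(G)=\max_{G^L}R(G^L)$, $R(G)=\min_{G^R}L(G^R)$. Sum: integer sum if both numbers, otherwise $G+H=\langle G^L+H, G+H^L\mid G^R+H, G+H^R\rangle$. $G\oplus_nH$ is defined as $\min(G+H,n-1)$ if both are numbers, and otherwise $\langle G^L\oplus_nH, G\oplus_nH^L\mid G^R\oplus_nH, G\oplus_nH^R\rangle$. $\{\oplus_n\}$-indistinguishability is the largest equivalence relation $\sim$ on $n$-valued games such that $G\sim H$ implies $(L(G),R(G))=(L(H),R(H))$, and $G\sim G'$, $H\sim H'$ imply $G\oplus_nH\sim G'\oplus_nH'$; equivalently, $G\sim H$ iff $(L(G\oplus_nX),R(G\oplus_nX))=(L(H\oplus_nX),R(H\oplus_nX))$ for every $n$-valued game $X$. -}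

module Defs where

open import Data.Nat using (ℕ; zero; suc; _+_; _∸_; _⊔_; _⊓_; _<_)
open import Data.List using (List; []; _∷_; _++_)
open import Data.List.Relation.Unary.All using (All)
open import Data.Product using (_×_; _,_)
open import Relation.Binary.PropositionalEquality using (_≡_)
open import Relation.Nullary using (¬_)

-- Nonemptiness of option sets and
-- temper are imposed by the predicate Tempered below.
data Game : Set where
  num   : ℕ → Game
  ⟨_∣_⟩ : List Game → List Game → Game

data Parity : Set where
  even odd : Parity

flip : Parity → Parity
flip even = odd
flip odd  = even

data Tempered : Parity → Game → Set where
  num  : ∀ m → Tempered even (num m)
  node : ∀ {p ls rs} → ¬ ls ≡ [] → ¬ rs ≡ [] →
         All (Tempered (flip p)) ls → All (Tempered (flip p)) rs →
         Tempered p ⟨ ls ∣ rs ⟩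

data Valued (n : ℕ) : Game → Set where
  num  : ∀ {m} → m < n → Valued n (num m)
  node : ∀ {ls rs} → All (Valued n) ls → All (Valued n) rs →
         Valued n ⟨ ls ∣ rs ⟩

WT : ℕ → Parity → Game → Set
WT n p G = Tempered p G × Valued n G

-- Outcomes L(G), R(G).  (The values for empty option lists are
-- arbitrary defaults; they never arise for tempered games.)
mutual
  Lo : Game → ℕ
  Lo (num m) = m
  Lo ⟨ ls ∣ rs ⟩ = maxR ls

  Ro : Game → ℕ
  Ro (num m) = m
  Ro ⟨ ls ∣ rs ⟩ = minL rs

  maxR : List Game → ℕ
  maxR [] = 0
  maxR (g ∷ []) = Ro g
  maxR (g ∷ gs@(_ ∷ _)) = Ro g ⊔ maxR gs

  minL : List Game → ℕ
  minL [] = 0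
  minL (g ∷ []) = Lo g
  minL (g ∷ gs@(_ ∷ _)) = Lo g ⊓ minL gs

outcome : Game → ℕ × ℕ
outcome G = Lo G , Ro G

module _ (f : ℕ → ℕ → ℕ) where
  mutual
    sumWith : Game → Game → Game
    sumWith (num a) (num b) = num (f a b)
    sumWith (num a) ⟨ hl ∣ hr ⟩ =
      ⟨ mapʳ (num a) hl ∣ mapʳ (num a) hr ⟩
    sumWith ⟨ gl ∣ gr ⟩ (num b) =
      ⟨ mapˡ gl (num b) ∣ mapˡ gr (num b) ⟩
    sumWith ⟨ gl ∣ gr ⟩ ⟨ hl ∣ hr ⟩ =
      ⟨ mapˡ gl ⟨ hl ∣ hr ⟩ ++ mapʳ ⟨ gl ∣ gr ⟩ hl
      ∣ mapˡ gr ⟨ hl ∣ hr ⟩ ++ mapʳ ⟨ gl ∣ gr ⟩ hr ⟩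

    mapˡ : List Game → Game → List Game
    mapˡ [] h = []
    mapˡ (g ∷ gs) h = sumWith g h ∷ mapˡ gs h

    mapʳ : Game → List Game → List Game
    mapʳ g [] = []
    mapʳ g (h ∷ hs) = sumWith g h ∷ mapʳ g hs

_+ᵍ_ : Game → Game → Game
_+ᵍ_ = sumWith _+_

⊕[_] : ℕ → Game → Game → Game
⊕[ n ] = sumWith (λ a b → (a + b) ⊓ (n ∸ 1))

⋆ : Game
⋆ = ⟨ num 0 ∷ [] ∣ num 0 ∷ [] ⟩

-- {⊕ₙ}-indistinguishability, via the characterisation:
-- G ∼ H iff outcomes of G ⊕ₙ X and H ⊕ₙ X agree for every n-valued game X
-- (well-tempered of either parity).
Indist : ℕ → Game → Game → Set
Indist n G H = ∀ p X → WT n p X → outcome (⊕[ n ] G X) ≡ outcome (⊕[ n ] H X)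

module Submission where

-- On n-valued games K ⊕ₙ 0 = K and K ⊕ₙ ⋆ = K + ⋆, and all outcomes are
-- at most n-1.
--
-- Backward direction (absorbing): if K and K ⊕ ⋆ are saturated then every
-- K ⊕ X is, by simultaneous induction on K and X; for X even the relevant
-- hypothesis is on K, for X odd on K ⊕ ⋆.
-- Forward direction (forward): with G even and H odd, testing against 0
-- and ⋆ equates the outcomes of G, H and of G ⊕ ⋆, H ⊕ ⋆.  The test game
-- probeEven = ⟨ s ∣ s ⟩, s = ⟨ n-1 ∣ 0 ⟩, lifts L of odd and R of even
-- games to n-1 without raising L of even or R of odd games; the test game
-- probeOdd = ⟨ probeEven ∣ probeEven ⟩ does the same relative to K ⊕ ⋆.
-- Together this forces L(G), R(H), L(H ⊕ ⋆), R(G ⊕ ⋆) to be n-1.  The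
-- case G odd, H even follows by symmetry.

open import Defs
open import Data.Nat using (ℕ; _≤_; _<_; _∸_; _+_; _⊓_; z≤n; s≤s)
open import Data.Nat.Properties
open import Data.Product using (_×_; _,_; proj₁; proj₂; ∃-syntax)
open import Data.Sum using (inj₁; inj₂)
open import Data.List using (List; []; _∷_; _++_; map)
open import Data.List.Properties using (++-identityʳ)
open import Data.List.Relation.Unary.All using (All; []; _∷_; tabulate)
open import Data.List.Relation.Unary.All.Properties using (++⁺)
open import Data.List.Relation.Unary.Any using (here; there)
open import Data.List.Membership.Propositional using (_∈_)
open import Data.List.Membership.Propositional.Properties
  using (∈-map⁺; ∈-map⁻; ∈-++⁺ˡ; ∈-++⁺ʳ; ∈-++⁻)
open import Data.Empty using (⊥-elim)
open import Relation.Nullary using (¬_)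
open import Relation.Binary.PropositionalEquality
open import Function.Bundles using (_⇔_; mk⇔; Equivalence)

∈⇒≢[] : ∀ {A : Set} {x : A} {xs} → x ∈ xs → ¬ xs ≡ []
∈⇒≢[] (here _) ()
∈⇒≢[] (there _) ()

some-member : ∀ {A : Set} {xs : List A} → ¬ xs ≡ [] → ∃[ x ] x ∈ xs
some-member {xs = []}    ne = ⊥-elim (ne refl)
some-member {xs = x ∷ _} ne = x , here refl

maxR-upper : ∀ {g gs} → g ∈ gs → Ro g ≤ maxR gs
maxR-upper {gs = _ ∷ []}    (here refl) = ≤-refl
maxR-upper {gs = _ ∷ _ ∷ _} (here refl) = m≤m⊔n _ _
maxR-upper {gs = _ ∷ []}    (there ())
maxR-upper {gs = g ∷ _ ∷ _} (there g∈) = ≤-trans (maxR-upper g∈) (m≤n⊔m (Ro g) _)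

maxR-least : ∀ {t} gs → (∀ {g} → g ∈ gs → Ro g ≤ t) → maxR gs ≤ t
maxR-least []               bound = z≤n
maxR-least (_ ∷ [])         bound = bound (here refl)
maxR-least (_ ∷ gs@(_ ∷ _)) bound =
  ⊔-lub (bound (here refl)) (maxR-least gs (λ g∈ → bound (there g∈)))

maxR-attained : ∀ gs → ¬ gs ≡ [] → ∃[ g ] g ∈ gs × maxR gs ≤ Ro g
maxR-attained []               ne = ⊥-elim (ne refl)
maxR-attained (g ∷ [])         ne = g , here refl , ≤-refl
maxR-attained (g ∷ gs@(_ ∷ _)) ne with maxR-attained gs (λ ()) | ⊔-sel (Ro g) (maxR gs)
... | _ , _ , _    | inj₁ first = g , here refl , ≤-reflexive first
... | h , h∈ , le | inj₂ rest  = h , there h∈ , ≤-trans (≤-reflexive rest) le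

minL-lower : ∀ {g gs} → g ∈ gs → minL gs ≤ Lo g
minL-lower {gs = _ ∷ []}    (here refl) = ≤-refl
minL-lower {gs = _ ∷ _ ∷ _} (here refl) = m⊓n≤m _ _
minL-lower {gs = _ ∷ []}    (there ())
minL-lower {gs = g ∷ _ ∷ _} (there g∈) = ≤-trans (m⊓n≤n (Lo g) _) (minL-lower g∈)

minL-greatest : ∀ {t} gs → ¬ gs ≡ [] → (∀ {g} → g ∈ gs → t ≤ Lo g) → t ≤ minL gs
minL-greatest []               ne bound = ⊥-elim (ne refl)
minL-greatest (_ ∷ [])         ne bound = bound (here refl)
minL-greatest (_ ∷ gs@(_ ∷ _)) ne bound =
  ⊓-glb (bound (here refl)) (minL-greatest gs (λ ()) (λ g∈ → bound (there g∈)))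

data Side : Set where
  left right : Side

opts : Side → Game → List Game
opts s     (num _)   = []
opts left  ⟨ l ∣ _ ⟩ = l
opts right ⟨ _ ∣ r ⟩ = r

Lo-option : ∀ G {g} → g ∈ opts left G → Ro g ≤ Lo G
Lo-option ⟨ _ ∣ _ ⟩ = maxR-upper

Lo-least : ∀ {t} G → ¬ opts left G ≡ [] →
           (∀ {g} → g ∈ opts left G → Ro g ≤ t) → Lo G ≤ t
Lo-least (num _)   ne bound = ⊥-elim (ne refl)
Lo-least ⟨ l ∣ _ ⟩ ne bound = maxR-least l bound

Lo-attained : ∀ G → ¬ opts left G ≡ [] → ∃[ g ] g ∈ opts left G × Lo G ≤ Ro g
Lo-attained (num _)   ne = ⊥-elim (ne refl)
Lo-attained ⟨ l ∣ _ ⟩ ne = maxR-attained l ne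

Ro-option : ∀ G {g} → g ∈ opts right G → Ro G ≤ Lo g
Ro-option ⟨ _ ∣ _ ⟩ = minL-lower

Ro-greatest : ∀ {t} G → ¬ opts right G ≡ [] →
              (∀ {g} → g ∈ opts right G → t ≤ Lo g) → t ≤ Ro G
Ro-greatest (num _)   ne bound = ⊥-elim (ne refl)
Ro-greatest ⟨ _ ∣ r ⟩ ne bound = minL-greatest r ne bound

module SumOptions (f : ℕ → ℕ → ℕ) where
  private
    _∘_ : Game → Game → Game
    _∘_ = sumWith f

  mapˡ-map : ∀ gs X → mapˡ f gs X ≡ map (_∘ X) gs
  mapˡ-map []       X = refl
  mapˡ-map (g ∷ gs) X = cong (g ∘ X ∷_) (mapˡ-map gs X)

  mapʳ-map : ∀ K xs → mapʳ f K xs ≡ map (K ∘_) xs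
  mapʳ-map K []       = refl
  mapʳ-map K (x ∷ xs) = cong (K ∘ x ∷_) (mapʳ-map K xs)

  opts-sum : ∀ s K X → opts s (K ∘ X) ≡ map (_∘ X) (opts s K) ++ map (K ∘_) (opts s X)
  opts-sum s     (num a)     (num b)     = refl
  opts-sum left  (num a)     ⟨ hl ∣ hr ⟩ = mapʳ-map (num a) hl
  opts-sum right (num a)     ⟨ hl ∣ hr ⟩ = mapʳ-map (num a) hr
  opts-sum left  ⟨ gl ∣ gr ⟩ (num b)     = trans (mapˡ-map gl (num b)) (sym (++-identityʳ _))
  opts-sum right ⟨ gl ∣ gr ⟩ (num b)     = trans (mapˡ-map gr (num b)) (sym (++-identityʳ _))
  opts-sum left  K@(⟨ gl ∣ gr ⟩) X@(⟨ hl ∣ hr ⟩) = cong₂ _++_ (mapˡ-map gl X) (mapʳ-map K hl)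
  opts-sum right K@(⟨ gl ∣ gr ⟩) X@(⟨ hl ∣ hr ⟩) = cong₂ _++_ (mapˡ-map gr X) (mapʳ-map K hr)

  ∈-sumˡ : ∀ {s g} K X → g ∈ opts s K → g ∘ X ∈ opts s (K ∘ X)
  ∈-sumˡ {s} K X g∈ rewrite opts-sum s K X = ∈-++⁺ˡ (∈-map⁺ (_∘ X) g∈)

  ∈-sumʳ : ∀ {s x} K X → x ∈ opts s X → K ∘ x ∈ opts s (K ∘ X)
  ∈-sumʳ {s} K X x∈ rewrite opts-sum s K X =
    ∈-++⁺ʳ (map (_∘ X) (opts s K)) (∈-map⁺ (K ∘_) x∈)

  sum-nonemptyˡ : ∀ s K X → ¬ opts s K ≡ [] → ¬ opts s (K ∘ X) ≡ []
  sum-nonemptyˡ s K X ne = let _ , g∈ = some-member ne in ∈⇒≢[] (∈-sumˡ K X g∈)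

  sum-nonemptyʳ : ∀ s K X → ¬ opts s X ≡ [] → ¬ opts s (K ∘ X) ≡ []
  sum-nonemptyʳ s K X ne = let _ , x∈ = some-member ne in ∈⇒≢[] (∈-sumʳ K X x∈)

  Lo-sumˡ : ∀ K X {g} → g ∈ opts left K → Ro (g ∘ X) ≤ Lo (K ∘ X)
  Lo-sumˡ K X g∈ = Lo-option (K ∘ X) (∈-sumˡ K X g∈)

  Lo-sumʳ : ∀ K X {x} → x ∈ opts left X → Ro (K ∘ x) ≤ Lo (K ∘ X)
  Lo-sumʳ K X x∈ = Lo-option (K ∘ X) (∈-sumʳ K X x∈)

  Ro-sumˡ : ∀ K X {g} → g ∈ opts right K → Ro (K ∘ X) ≤ Lo (g ∘ X)
  Ro-sumˡ K X g∈ = Ro-option (K ∘ X) (∈-sumˡ K X g∈)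

  Ro-sumʳ : ∀ K X {x} → x ∈ opts right X → Ro (K ∘ X) ≤ Lo (K ∘ x)
  Ro-sumʳ K X x∈ = Ro-option (K ∘ X) (∈-sumʳ K X x∈)

  sum-options-all : ∀ {P : Game → Set} s K X →
    (∀ {g} → g ∈ opts s K → P (g ∘ X)) → (∀ {x} → x ∈ opts s X → P (K ∘ x)) →
    ∀ {y} → y ∈ opts s (K ∘ X) → P y
  sum-options-all s K X onK onX y∈ rewrite opts-sum s K X
    with ∈-++⁻ (map (_∘ X) (opts s K)) y∈
  ... | inj₁ y∈K with ∈-map⁻ (_∘ X) y∈K
  ...   | _ , g∈ , refl = onK g∈
  sum-options-all s K X onK onX y∈ | inj₂ y∈X with ∈-map⁻ (K ∘_) y∈X
  ...   | _ , x∈ , refl = onX x∈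

  Lo-sum-least : ∀ {t} K X → ¬ opts left (K ∘ X) ≡ [] →
    (∀ {g} → g ∈ opts left K → Ro (g ∘ X) ≤ t) →
    (∀ {x} → x ∈ opts left X → Ro (K ∘ x) ≤ t) →
    Lo (K ∘ X) ≤ t
  Lo-sum-least K X ne onK onX = Lo-least (K ∘ X) ne (sum-options-all left K X onK onX)

  Ro-sum-greatest : ∀ {t} K X → ¬ opts right (K ∘ X) ≡ [] →
    (∀ {g} → g ∈ opts right K → t ≤ Lo (g ∘ X)) →
    (∀ {x} → x ∈ opts right X → t ≤ Lo (K ∘ x)) →
    t ≤ Ro (K ∘ X)
  Ro-sum-greatest K X ne onK onX = Ro-greatest (K ∘ X) ne (sum-options-all right K X onK onX)

module _ {n : ℕ} (f : ℕ → ℕ → ℕ) (f-identity : ∀ {a} → a < n → f a 0 ≡ a) where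
  mutual
    sum-identityʳ : ∀ {K} → Valued n K → sumWith f K (num 0) ≡ K
    sum-identityʳ (num a<n)    = cong num (f-identity a<n)
    sum-identityʳ (node vl vr) = cong₂ ⟨_∣_⟩ (mapˡ-identityʳ vl) (mapˡ-identityʳ vr)

    mapˡ-identityʳ : ∀ {gs} → All (Valued n) gs → mapˡ f gs (num 0) ≡ gs
    mapˡ-identityʳ []       = refl
    mapˡ-identityʳ (v ∷ vs) = cong₂ _∷_ (sum-identityʳ v) (mapˡ-identityʳ vs)

module _ {n : ℕ} where
  <⇒≤top : ∀ {m} → m < n → m ≤ n ∸ 1
  <⇒≤top = ∸-monoˡ-≤ 1

  mutual
    Lo-bounded : ∀ {G} → Valued n G → Lo G ≤ n ∸ 1
    Lo-bounded (num a<n)   = <⇒≤top a<n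
    Lo-bounded (node vl _) = maxR-bounded vl

    Ro-bounded : ∀ {G} → Valued n G → Ro G ≤ n ∸ 1
    Ro-bounded (num a<n)   = <⇒≤top a<n
    Ro-bounded (node _ vr) = minL-bounded vr

    maxR-bounded : ∀ {gs} → All (Valued n) gs → maxR gs ≤ n ∸ 1
    maxR-bounded []               = z≤n
    maxR-bounded (v ∷ [])         = Ro-bounded v
    maxR-bounded (v ∷ vs@(_ ∷ _)) = ⊔-lub (Ro-bounded v) (maxR-bounded vs)

    minL-bounded : ∀ {gs} → All (Valued n) gs → minL gs ≤ n ∸ 1
    minL-bounded []               = z≤n
    minL-bounded (v ∷ [])         = Lo-bounded v
    minL-bounded (v ∷ vs@(_ ∷ _)) = ≤-trans (m⊓n≤m _ _) (Lo-bounded v)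

module _ {n : ℕ} (f : ℕ → ℕ → ℕ) (f-valued : ∀ a b → f a b < n) where
  mutual
    sum-valued : ∀ K X → Valued n (sumWith f K X)
    sum-valued (num a)     (num b)     = num (f-valued a b)
    sum-valued (num a)     ⟨ hl ∣ hr ⟩ = node (mapʳ-valued (num a) hl) (mapʳ-valued (num a) hr)
    sum-valued ⟨ gl ∣ gr ⟩ (num b)     = node (mapˡ-valued gl (num b)) (mapˡ-valued gr (num b))
    sum-valued K@(⟨ gl ∣ gr ⟩) X@(⟨ hl ∣ hr ⟩) =
      node (++⁺ (mapˡ-valued gl X) (mapʳ-valued K hl)) (++⁺ (mapˡ-valued gr X) (mapʳ-valued K hr))

    mapˡ-valued : ∀ gs X → All (Valued n) (mapˡ f gs X)
    mapˡ-valued []       X = []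
    mapˡ-valued (g ∷ gs) X = sum-valued g X ∷ mapˡ-valued gs X

    mapʳ-valued : ∀ K xs → All (Valued n) (mapʳ f K xs)
    mapʳ-valued K []       = []
    mapʳ-valued K (x ∷ xs) = sum-valued K x ∷ mapʳ-valued K xs

-- n-valued well-tempered games with the children of a node given as a
-- function on membership proofs: recursion on this presentation is
-- structural, which is what the inductive arguments below need.
data WellTempered (n : ℕ) : Parity → Game → Set where
  num  : ∀ {m} → m < n → WellTempered n even (num m)
  node : ∀ {p ls rs} → ¬ ls ≡ [] → ¬ rs ≡ [] →
         (∀ {g} → g ∈ ls → WellTempered n (flip p) g) →
         (∀ {g} → g ∈ rs → WellTempered n (flip p) g) →
         WellTempered n p ⟨ ls ∣ rs ⟩

mutual
  fromWT : ∀ {n p G} → Tempered p G → Valued n G → WellTempered n p G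
  fromWT (num _)            (num m<n)    = num m<n
  fromWT (node nl nr tl tr) (node vl vr) = node nl nr (children tl vl) (children tr vr)

  children : ∀ {n p gs} → All (Tempered p) gs → All (Valued n) gs →
             ∀ {g} → g ∈ gs → WellTempered n p g
  children (t ∷ _)  (v ∷ _)  (here refl) = fromWT t v
  children (_ ∷ ts) (_ ∷ vs) (there g∈)  = children ts vs g∈

wellTempered : ∀ {n p G} → WT n p G → WellTempered n p G
wellTempered (t , v) = fromWT t v

valued : ∀ {n p G} → WellTempered n p G → Valued n G
valued (num m<n)         = num m<n
valued (node _ _ lG rG) =
  node (tabulate (λ g∈ → valued (lG g∈))) (tabulate (λ g∈ → valued (rG g∈)))

module Capped (n : ℕ) where
  top : ℕ
  top = n ∸ 1

  capAdd : ℕ → ℕ → ℕ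
  capAdd a b = (a + b) ⊓ top

  _⊕_ : Game → Game → Game
  _⊕_ = ⊕[ n ]

  open SumOptions capAdd

  saturatesˡ : ∀ {a} b → top ≤ a → top ≤ capAdd a b
  saturatesˡ {a} b h = ⊓-glb (≤-trans h (m≤m+n a b)) ≤-refl

  saturatesʳ : ∀ a {b} → top ≤ b → top ≤ capAdd a b
  saturatesʳ a {b} h = ⊓-glb (≤-trans h (m≤n+m b a)) ≤-refl

  capAdd-identityʳ : ∀ {a} → a < n → capAdd a 0 ≡ a
  capAdd-identityʳ {a} a<n = begin
    (a + 0) ⊓ top  ≡⟨ cong (_⊓ top) (+-identityʳ a) ⟩
    a ⊓ top        ≡⟨ m≤n⇒m⊓n≡m (<⇒≤top a<n) ⟩
    a              ∎
    where open ≡-Reasoning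

  ⊕-identityʳ : ∀ {K} → Valued n K → K ⊕ num 0 ≡ K
  ⊕-identityʳ = sum-identityʳ capAdd capAdd-identityʳ

  ⊕0≡+0 : ∀ {K} → Valued n K → K ⊕ num 0 ≡ K +ᵍ num 0
  ⊕0≡+0 v = trans (⊕-identityʳ v) (sym (sum-identityʳ _+_ (λ {a} _ → +-identityʳ a) v))

  -- On n-valued games the capped sum with ⋆ is the ordinary sum with ⋆:
  -- both are ⟨ Kᴸ ∘ ⋆ , K ∘ 0 ∣ Kᴿ ∘ ⋆ , K ∘ 0 ⟩ and K ∘ 0 = K for both.
  mutual
    ⊕⋆≡+⋆ : ∀ {K} → Valued n K → K ⊕ ⋆ ≡ K +ᵍ ⋆
    ⊕⋆≡+⋆ v@(num _) = cong (λ K0 → ⟨ K0 ∷ [] ∣ K0 ∷ [] ⟩) (⊕0≡+0 v)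
    ⊕⋆≡+⋆ v@(node vl vr) = cong₂ ⟨_∣_⟩
      (cong₂ _++_ (mapˡ-⊕⋆≡+⋆ vl) (cong (_∷ []) (⊕0≡+0 v)))
      (cong₂ _++_ (mapˡ-⊕⋆≡+⋆ vr) (cong (_∷ []) (⊕0≡+0 v)))

    mapˡ-⊕⋆≡+⋆ : ∀ {gs} → All (Valued n) gs → mapˡ capAdd gs ⋆ ≡ mapˡ _+_ gs ⋆
    mapˡ-⊕⋆≡+⋆ []       = refl
    mapˡ-⊕⋆≡+⋆ (v ∷ vs) = cong₂ _∷_ (⊕⋆≡+⋆ v) (mapˡ-⊕⋆≡+⋆ vs)

  -- K ⊕ 0 = K is both a left and a right option of K ⊕ ⋆.
  Ro≤Lo⋆ : ∀ {K} → Valued n K → Ro K ≤ Lo (K ⊕ ⋆)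
  Ro≤Lo⋆ {K} v =
    subst (λ K0 → Ro K0 ≤ Lo (K ⊕ ⋆)) (⊕-identityʳ v) (Lo-sumʳ K ⋆ (here refl))

  Ro⋆≤Lo : ∀ {K} → Valued n K → Ro (K ⊕ ⋆) ≤ Lo K
  Ro⋆≤Lo {K} v =
    subst (λ K0 → Ro (K ⊕ ⋆) ≤ Lo K0) (⊕-identityʳ v) (Ro-sumʳ K ⋆ (here refl))

  mutual
    absorb-Lo-even : ∀ {p K X} → WellTempered n p K → WellTempered n even X →
                     top ≤ Lo K → top ≤ Lo (K ⊕ X)
    absorb-Lo-even (num _) (num _) h = saturatesˡ _ h
    absorb-Lo-even {K = K} {X} tK@(num _) (node nl _ lX _) h =
      let _ , x∈ = some-member nl in
      -- for a number K, R(K ⊕ ⋆) is the number K ⊕ 0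
      ≤-trans (absorb-Ro-odd tK (lX x∈) (saturatesˡ 0 h)) (Lo-sumʳ K X x∈)
    absorb-Lo-even {K = K} {X} (node nl _ lK _) tX h =
      let _ , g∈ , Lo≤ = Lo-attained K nl in
      ≤-trans (absorb-Ro-even (lK g∈) tX (≤-trans h Lo≤)) (Lo-sumˡ K X g∈)

    absorb-Ro-even : ∀ {p K X} → WellTempered n p K → WellTempered n even X →
                     top ≤ Ro K → top ≤ Ro (K ⊕ X)
    absorb-Ro-even (num _) (num _) h = saturatesˡ _ h
    absorb-Ro-even {K = K} {X} tK@(num _) tX@(node _ nr _ _) h =
      Ro-sum-greatest K X (sum-nonemptyʳ right K X nr)
        (absorb-even-Kᴿ tK tX h) (absorb-even-Xᴿ tK tX h)
    absorb-Ro-even {K = K} {X} tK@(node _ nr _ _) tX h =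
      Ro-sum-greatest K X (sum-nonemptyˡ right K X nr)
        (absorb-even-Kᴿ tK tX h) (absorb-even-Xᴿ tK tX h)

    absorb-even-Kᴿ : ∀ {p K X} → WellTempered n p K → WellTempered n even X →
                     top ≤ Ro K → ∀ {g} → g ∈ opts right K → top ≤ Lo (g ⊕ X)
    absorb-even-Kᴿ {K = K} (node _ _ _ rK) tX h g∈ =
      absorb-Lo-even (rK g∈) tX (≤-trans h (Ro-option K g∈))

    absorb-even-Xᴿ : ∀ {p K X} → WellTempered n p K → WellTempered n even X →
                     top ≤ Ro K → ∀ {x} → x ∈ opts right X → top ≤ Lo (K ⊕ x)
    absorb-even-Xᴿ tK (node _ _ _ rX) h x∈ =
      absorb-Lo-odd tK (rX x∈) (≤-trans h (Ro≤Lo⋆ (valued tK)))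

    absorb-Lo-odd : ∀ {p K X} → WellTempered n p K → WellTempered n odd X →
                    top ≤ Lo (K ⊕ ⋆) → top ≤ Lo (K ⊕ X)
    absorb-Lo-odd {K = K} {X} tK tX@(node nl _ lX _) h =
      let _ , y∈ , Lo≤ = Lo-attained (K ⊕ ⋆) (sum-nonemptyʳ left K ⋆ (λ ())) in
      sum-options-all {P = λ y → top ≤ Ro y → top ≤ Lo (K ⊕ X)} left K ⋆
        (absorb-odd-Kᴸ tK tX) viaK0 y∈ (≤-trans h Lo≤)
      where
      viaK0 : ∀ {x} → x ∈ opts left ⋆ → top ≤ Ro (K ⊕ x) → top ≤ Lo (K ⊕ X)
      viaK0 (here refl) h' =
        let _ , x∈ = some-member nl
            top≤RoK = subst (λ K0 → top ≤ Ro K0) (⊕-identityʳ (valued tK)) h'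
        in ≤-trans (absorb-Ro-even tK (lX x∈) top≤RoK) (Lo-sumʳ K X x∈)

    absorb-odd-Kᴸ : ∀ {p K X} → WellTempered n p K → WellTempered n odd X →
                    ∀ {g} → g ∈ opts left K → top ≤ Ro (g ⊕ ⋆) → top ≤ Lo (K ⊕ X)
    absorb-odd-Kᴸ {K = K} {X} (node _ _ lK _) tX g∈ h =
      ≤-trans (absorb-Ro-odd (lK g∈) tX h) (Lo-sumˡ K X g∈)

    absorb-Ro-odd : ∀ {p K X} → WellTempered n p K → WellTempered n odd X →
                    top ≤ Ro (K ⊕ ⋆) → top ≤ Ro (K ⊕ X)
    absorb-Ro-odd {K = K} {X} tK tX@(node _ nr _ rX) h =
      Ro-sum-greatest K X (sum-nonemptyʳ right K X nr)
        (absorb-odd-Kᴿ tK tX h)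
          (λ x∈ → absorb-Lo-even tK (rX x∈) (≤-trans h (Ro⋆≤Lo (valued tK))))

    absorb-odd-Kᴿ : ∀ {p K X} → WellTempered n p K → WellTempered n odd X →
                    top ≤ Ro (K ⊕ ⋆) → ∀ {g} → g ∈ opts right K → top ≤ Lo (g ⊕ X)
    absorb-odd-Kᴿ {K = K} (node _ _ _ rK) tX h g∈ =
      absorb-Lo-odd (rK g∈) tX (≤-trans h (Ro-sumˡ K ⋆ g∈))

  switch probeEven probeOdd : Game
  switch    = ⟨ num top ∷ [] ∣ num 0 ∷ [] ⟩
  probeEven = ⟨ switch ∷ [] ∣ switch ∷ [] ⟩
  probeOdd  = ⟨ probeEven ∷ [] ∣ probeEven ∷ [] ⟩

  mutual
    ⊕top-Lo : ∀ {p K} → WellTempered n p K → top ≤ Lo (K ⊕ num top)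
    ⊕top-Lo (num _) = saturatesʳ _ ≤-refl
    ⊕top-Lo {K = K} (node nl _ lK _) =
      let _ , g∈ = some-member nl in ≤-trans (⊕top-Ro (lK g∈)) (Lo-sumˡ K (num top) g∈)

    ⊕top-Ro : ∀ {p K} → WellTempered n p K → top ≤ Ro (K ⊕ num top)
    ⊕top-Ro (num _) = saturatesʳ _ ≤-refl
    ⊕top-Ro {K = K} (node _ nr _ rK) =
      Ro-sum-greatest K (num top) (sum-nonemptyˡ right K (num top) nr)
        (λ g∈ → ⊕top-Lo (rK g∈)) (λ ())

  -- Left can move K ⊕ switch to K ⊕ (n-1); Right can move it to K ⊕ 0 = K.
  switch-Lo : ∀ {p K} → WellTempered n p K → top ≤ Lo (K ⊕ switch)
  switch-Lo {K = K} tK = ≤-trans (⊕top-Ro tK) (Lo-sumʳ K switch (here refl))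

  switch-Ro : ∀ {K} → Valued n K → Ro (K ⊕ switch) ≤ Lo K
  switch-Ro {K} v =
    subst (λ K0 → Ro (K ⊕ switch) ≤ Lo K0) (⊕-identityʳ v) (Ro-sumʳ K switch (here refl))

  mutual
    probeEven-Lo-odd : ∀ {K} → WellTempered n odd K → top ≤ Lo (K ⊕ probeEven)
    probeEven-Lo-odd {K} (node nl _ lK _) =
      let _ , g∈ = some-member nl in ≤-trans (probeEven-Ro-even (lK g∈)) (Lo-sumˡ K probeEven g∈)

    probeEven-Ro-even : ∀ {K} → WellTempered n even K → top ≤ Ro (K ⊕ probeEven)
    probeEven-Ro-even {K} tK@(num _) =
      Ro-sum-greatest K probeEven (sum-nonemptyʳ right K probeEven (λ ()))
        (λ ()) (λ { (here refl) → switch-Lo tK })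
    probeEven-Ro-even {K} tK@(node _ nr _ rK) =
      Ro-sum-greatest K probeEven (sum-nonemptyˡ right K probeEven nr)
        (λ g∈ → probeEven-Lo-odd (rK g∈)) (λ { (here refl) → switch-Lo tK })

  mutual
    probeEven-Lo-even : ∀ {K} → WellTempered n even K → Lo (K ⊕ probeEven) ≤ Lo K
    probeEven-Lo-even {K} tK@(num _) =
      Lo-sum-least K probeEven (sum-nonemptyʳ left K probeEven (λ ()))
        (λ ()) (λ { (here refl) → switch-Ro (valued tK) })
    probeEven-Lo-even {K} tK@(node nl _ lK _) =
      Lo-sum-least K probeEven (sum-nonemptyˡ left K probeEven nl)
        (λ g∈ → ≤-trans (probeEven-Ro-odd (lK g∈)) (Lo-option K g∈))
          (λ { (here refl) → switch-Ro (valued tK) })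

    probeEven-Ro-odd : ∀ {K} → WellTempered n odd K → Ro (K ⊕ probeEven) ≤ Ro K
    probeEven-Ro-odd {K} (node _ nr _ rK) =
      Ro-greatest K nr (λ g∈ → ≤-trans (Ro-sumˡ K probeEven g∈) (probeEven-Lo-even (rK g∈)))

  probeOdd-Lo-even : ∀ {K} → WellTempered n even K → top ≤ Lo (K ⊕ probeOdd)
  probeOdd-Lo-even {K} tK = ≤-trans (probeEven-Ro-even tK) (Lo-sumʳ K probeOdd (here refl))

  probeOdd-Ro-odd : ∀ {K} → WellTempered n odd K → top ≤ Ro (K ⊕ probeOdd)
  probeOdd-Ro-odd {K} tK@(node _ nr _ rK) =
    Ro-sum-greatest K probeOdd (sum-nonemptyˡ right K probeOdd nr)
      (λ g∈ → probeOdd-Lo-even (rK g∈)) (λ { (here refl) → probeEven-Lo-odd tK })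

  probeOdd-Ro≤Lo : ∀ {K} → WellTempered n even K → Ro (K ⊕ probeOdd) ≤ Lo (K ⊕ num 0)
  probeOdd-Ro≤Lo {K} tK = begin
    Ro (K ⊕ probeOdd)   ≤⟨ Ro-sumʳ K probeOdd (here refl) ⟩
    Lo (K ⊕ probeEven)  ≤⟨ probeEven-Lo-even tK ⟩
    Lo K                ≡⟨ cong Lo (⊕-identityʳ (valued tK)) ⟨
    Lo (K ⊕ num 0)      ∎
    where open ≤-Reasoning

  mutual
    probeOdd-Ro-even : ∀ {K} → WellTempered n even K → Ro (K ⊕ probeOdd) ≤ Ro (K ⊕ ⋆)
    probeOdd-Ro-even {K} tK@(num _) =
      Ro-sum-greatest K ⋆ (sum-nonemptyʳ right K ⋆ (λ ()))
        (λ ()) (λ { (here refl) → probeOdd-Ro≤Lo tK })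
    probeOdd-Ro-even {K} tK@(node _ _ _ rK) =
      Ro-sum-greatest K ⋆ (sum-nonemptyʳ right K ⋆ (λ ()))
        (λ g∈ → ≤-trans (Ro-sumˡ K probeOdd g∈) (probeOdd-Lo-odd (rK g∈)))
          (λ { (here refl) → probeOdd-Ro≤Lo tK })

    probeOdd-Lo-odd : ∀ {K} → WellTempered n odd K → Lo (K ⊕ probeOdd) ≤ Lo (K ⊕ ⋆)
    probeOdd-Lo-odd {K} tK@(node nl _ lK _) =
      Lo-sum-least K probeOdd (sum-nonemptyˡ left K probeOdd nl)
        (λ g∈ → ≤-trans (probeOdd-Ro-even (lK g∈)) (Lo-sumˡ K ⋆ g∈))
          (λ { (here refl) → ≤-trans (probeEven-Ro-odd tK) (Ro≤Lo⋆ (valued tK)) })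

  Saturated : Game → Set
  Saturated K = outcome K ≡ (top , top)

  saturated : ∀ {K} → Valued n K → top ≤ Lo K → top ≤ Ro K → Saturated K
  saturated v top≤Lo top≤Ro =
    cong₂ _,_ (≤-antisym (Lo-bounded v) top≤Lo) (≤-antisym (Ro-bounded v) top≤Ro)

  top≤Lo : ∀ K → Saturated K → top ≤ Lo K
  top≤Lo _ sat = ≤-reflexive (sym (cong proj₁ sat))

  top≤Ro : ∀ K → Saturated K → top ≤ Ro K
  top≤Ro _ sat = ≤-reflexive (sym (cong proj₂ sat))

  saturated-pair : ∀ {A B} → Valued n A → Valued n B → outcome A ≡ outcome B →
                   top ≤ Lo A → top ≤ Ro B → Saturated A × Saturated B
  saturated-pair vA vB same top≤LoA top≤RoB =
    saturated vA top≤LoA (≤-trans top≤RoB (≤-reflexive (sym (cong proj₂ same)))) ,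
    saturated vB (≤-trans top≤LoA (≤-reflexive (cong proj₁ same))) top≤RoB

  top<n : 1 ≤ n → top < n
  top<n = ∸-monoʳ-< (s≤s z≤n)

  ⊕-valued : 1 ≤ n → ∀ K X → Valued n (K ⊕ X)
  ⊕-valued 1≤n = sum-valued capAdd (λ a b → m<n⇒o⊓m<n (a + b) (top<n 1≤n))

  absorbing : 1 ≤ n → ∀ {p q K X} → WellTempered n p K → Saturated K → Saturated (K ⊕ ⋆) →
              WellTempered n q X → Saturated (K ⊕ X)
  absorbing 1≤n {q = even} {K} {X} tK satK _ tX =
    saturated (⊕-valued 1≤n K X) (absorb-Lo-even tK tX (top≤Lo K satK))
                                 (absorb-Ro-even tK tX (top≤Ro K satK))
  absorbing 1≤n {q = odd} {K} {X} tK _ sat⋆ tX =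
    saturated (⊕-valued 1≤n K X) (absorb-Lo-odd tK tX (top≤Lo (K ⊕ ⋆) sat⋆))
                                 (absorb-Ro-odd tK tX (top≤Ro (K ⊕ ⋆) sat⋆))

  wt-zero : 1 ≤ n → WT n even (num 0)
  wt-zero 1≤n = num 0 , num 1≤n

  wt-⋆ : 1 ≤ n → WT n odd ⋆
  wt-⋆ 1≤n =
    node (λ ()) (λ ()) (num 0 ∷ []) (num 0 ∷ []) , node (num 1≤n ∷ []) (num 1≤n ∷ [])

  wt-probeEven : 1 ≤ n → WT n even probeEven
  wt-probeEven 1≤n =
    node (λ ()) (λ ()) (t-switch ∷ []) (t-switch ∷ []) , node (v-switch ∷ []) (v-switch ∷ [])
    where
    t-switch : Tempered odd switch
    t-switch = node (λ ()) (λ ()) (num top ∷ []) (num 0 ∷ [])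
    v-switch : Valued n switch
    v-switch = node (num (top<n 1≤n) ∷ []) (num 1≤n ∷ [])

  wt-probeOdd : 1 ≤ n → WT n odd probeOdd
  wt-probeOdd 1≤n = node (λ ()) (λ ()) (t ∷ []) (t ∷ []) , node (v ∷ []) (v ∷ [])
    where
    t : Tempered even probeEven
    t = proj₁ (wt-probeEven 1≤n)
    v : Valued n probeEven
    v = proj₂ (wt-probeEven 1≤n)

  forward : 1 ≤ n → ∀ {G H} → WellTempered n even G → WellTempered n odd H → Indist n G H →
            Saturated G × Saturated (G ⊕ ⋆) × Saturated H × Saturated (H ⊕ ⋆)
  forward 1≤n {G} {H} tG tH indist =
    let satG , satH   = saturated-pair (valued tG) (valued tH) same Lo-G Ro-H
        satH⋆ , satG⋆ = saturated-pair (⊕-valued 1≤n H ⋆) (⊕-valued 1≤n G ⋆) same⋆ Lo-H⋆ Ro-G⋆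
    in satG , satG⋆ , satH , satH⋆
    where
    open ≤-Reasoning
    same-probeEven : outcome (G ⊕ probeEven) ≡ outcome (H ⊕ probeEven)
    same-probeEven = indist even probeEven (wt-probeEven 1≤n)

    same-probeOdd : outcome (G ⊕ probeOdd) ≡ outcome (H ⊕ probeOdd)
    same-probeOdd = indist odd probeOdd (wt-probeOdd 1≤n)

    same : outcome G ≡ outcome H
    same = trans (cong outcome (sym (⊕-identityʳ (valued tG))))
                 (trans (indist even (num 0) (wt-zero 1≤n)) (cong outcome (⊕-identityʳ (valued tH))))

    same⋆ : outcome (H ⊕ ⋆) ≡ outcome (G ⊕ ⋆)
    same⋆ = sym (indist odd ⋆ (wt-⋆ 1≤n))

    Lo-G : top ≤ Lo G
    Lo-G = begin
      top                  ≤⟨ probeEven-Lo-odd tH ⟩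
      Lo (H ⊕ probeEven)   ≡⟨ cong proj₁ same-probeEven ⟨
      Lo (G ⊕ probeEven)   ≤⟨ probeEven-Lo-even tG ⟩
      Lo G                 ∎

    Ro-H : top ≤ Ro H
    Ro-H = begin
      top                  ≤⟨ probeEven-Ro-even tG ⟩
      Ro (G ⊕ probeEven)   ≡⟨ cong proj₂ same-probeEven ⟩
      Ro (H ⊕ probeEven)   ≤⟨ probeEven-Ro-odd tH ⟩
      Ro H                 ∎

    Lo-H⋆ : top ≤ Lo (H ⊕ ⋆)
    Lo-H⋆ = begin
      top                  ≤⟨ probeOdd-Lo-even tG ⟩
      Lo (G ⊕ probeOdd)    ≡⟨ cong proj₁ same-probeOdd ⟩
      Lo (H ⊕ probeOdd)    ≤⟨ probeOdd-Lo-odd tH ⟩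
      Lo (H ⊕ ⋆)           ∎

    Ro-G⋆ : top ≤ Ro (G ⊕ ⋆)
    Ro-G⋆ = begin
      top                  ≤⟨ probeOdd-Ro-odd tH ⟩
      Ro (H ⊕ probeOdd)    ≡⟨ cong proj₂ same-probeOdd ⟨
      Ro (G ⊕ probeOdd)    ≤⟨ probeOdd-Ro-even tG ⟩
      Ro (G ⊕ ⋆)           ∎

  characterisation : 1 ≤ n → ∀ {G H} → WellTempered n even G → WellTempered n odd H →
    Indist n G H ⇔ (Saturated G × Saturated (G +ᵍ ⋆) × Saturated H × Saturated (H +ᵍ ⋆))
  characterisation 1≤n {G} {H} tG tH = mk⇔ to from
    where
    ⊕⋆ : ∀ {p K} → WellTempered n p K → K ⊕ ⋆ ≡ K +ᵍ ⋆
    ⊕⋆ tK = ⊕⋆≡+⋆ (valued tK)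

    to : Indist n G H → Saturated G × Saturated (G +ᵍ ⋆) × Saturated H × Saturated (H +ᵍ ⋆)
    to indist =
      let satG , satG⋆ , satH , satH⋆ = forward 1≤n tG tH indist
      in satG , subst Saturated (⊕⋆ tG) satG⋆ , satH , subst Saturated (⊕⋆ tH) satH⋆

    from : Saturated G × Saturated (G +ᵍ ⋆) × Saturated H × Saturated (H +ᵍ ⋆) → Indist n G H
    from (satG , satG⋆ , satH , satH⋆) _ _ wX =
      trans (absorbing 1≤n tG satG (subst Saturated (sym (⊕⋆ tG)) satG⋆) (wellTempered wX))
       (sym (absorbing 1≤n tH satH (subst Saturated (sym (⊕⋆ tH)) satH⋆) (wellTempered wX)))

Indist-sym : ∀ n G H → Indist n G H → Indist n H G
Indist-sym n G H indist p X wX = sym (indist p X wX)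

mainTheorem19 : (n : ℕ) → 1 ≤ n → (p : Parity) → (G H : Game) →
                WT n p G → WT n (flip p) H →
                (Indist n G H ⇔
                  (outcome G ≡ (n ∸ 1 , n ∸ 1) ×
                   outcome (G +ᵍ ⋆) ≡ (n ∸ 1 , n ∸ 1) ×
                   outcome H ≡ (n ∸ 1 , n ∸ 1) ×
                   outcome (H +ᵍ ⋆) ≡ (n ∸ 1 , n ∸ 1)))
mainTheorem19 n 1≤n even G H wG wH =
  Capped.characterisation n 1≤n (wellTempered wG) (wellTempered wH)
mainTheorem19 n 1≤n odd  G H wG wH =
  mk⇔ (λ indist → swap (Equivalence.to byParity (Indist-sym n G H indist)))
      (λ sat    → Indist-sym n H G (Equivalence.from byParity (swap sat)))
  where
  open Capped n using (Saturated)
  byParity : Indist n H G ⇔ (Saturated H × Saturated (H +ᵍ ⋆) × Saturated G × Saturated (G +ᵍ ⋆))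
  byParity = Capped.characterisation n 1≤n (wellTempered wH) (wellTempered wG)
  swap : ∀ {A B C D : Set} → A × B × C × D → C × D × A × B
  swap (a , b , c , d) = c , d , a , b
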